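{- Let $\Sigma_5=\{0,1,2,3,4\}$, let $h$ be the morphism $h(0)=012321012340121012321234$, $h(1)=012101234323401234321234$, $h(2)=012101232123401232101234$, $h(3)=012321234323401232101234$, $h(4)=012321234012101234321234$, and let $g:\Sigma_5^*\to\{0,1\}^*$ be the morphism $g(0)=011100$, $g(1)=101100$, $g(2)=111000$, $g(3)=110010$, $g(4)=110001$. Let $h'$ be the substitution $h'(0)=\{h(0),\,012101232123401234321234\}$ and $h'(a)=\{h(a)\}$ for $a\in\{1,2,3,4\}$. Let $m$ be a positive integer and $w=h^m(0)$. Then $g(h'(w))$ is a set of at least $2^{n/1152}$ binary words, each of length $n=144\cdot 24^m$, and each of these words contains no squares other than $00$, $11$ and $0101$.
   Context: For a word $w=a_1\cdots a_k$, $h'(w)$ is the set of all words $u_1\cdots u_k$ with $u_i\in h'(a_i)$, and $g(h'(w))=\{g(u):u\in h'(w)\}$. A square is a nonempty word $xx$ occurring as a contiguous subword. -}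

module Defs where

open import Data.Nat using (ℕ; zero; suc)
open import Data.Fin using (Fin; zero; suc)
open import Data.List using (List; []; _∷_; _++_; concatMap)
open import Data.List.Membership.Propositional using (_∈_)
open import Data.Product using (_×_; ∃)
open import Relation.Binary.PropositionalEquality using (_≡_)
open import Relation.Nullary using (¬_)
open import Data.Sum using (_⊎_)

Σ₅ : Set
Σ₅ = Fin 5

Bin : Set
Bin = Fin 2

pattern #0 = zero
pattern #1 = suc #0
pattern #2 = suc #1
pattern #3 = suc #2
pattern #4 = suc #3

pattern b0 = zero
pattern b1 = suc zero

h : Σ₅ → List Σ₅
h #0 = #0 ∷ #1 ∷ #2 ∷ #3 ∷ #2 ∷ #1 ∷ #0 ∷ #1 ∷ #2 ∷ #3 ∷ #4 ∷ #0 ∷ #1 ∷ #2 ∷ #1 ∷ #0 ∷ #1 ∷ #2 ∷ #3 ∷ #2 ∷ #1 ∷ #2 ∷ #3 ∷ #4 ∷ []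
h #1 = #0 ∷ #1 ∷ #2 ∷ #1 ∷ #0 ∷ #1 ∷ #2 ∷ #3 ∷ #4 ∷ #3 ∷ #2 ∷ #3 ∷ #4 ∷ #0 ∷ #1 ∷ #2 ∷ #3 ∷ #4 ∷ #3 ∷ #2 ∷ #1 ∷ #2 ∷ #3 ∷ #4 ∷ []
h #2 = #0 ∷ #1 ∷ #2 ∷ #1 ∷ #0 ∷ #1 ∷ #2 ∷ #3 ∷ #2 ∷ #1 ∷ #2 ∷ #3 ∷ #4 ∷ #0 ∷ #1 ∷ #2 ∷ #3 ∷ #2 ∷ #1 ∷ #0 ∷ #1 ∷ #2 ∷ #3 ∷ #4 ∷ []
h #3 = #0 ∷ #1 ∷ #2 ∷ #3 ∷ #2 ∷ #1 ∷ #2 ∷ #3 ∷ #4 ∷ #3 ∷ #2 ∷ #3 ∷ #4 ∷ #0 ∷ #1 ∷ #2 ∷ #3 ∷ #2 ∷ #1 ∷ #0 ∷ #1 ∷ #2 ∷ #3 ∷ #4 ∷ []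
h #4 = #0 ∷ #1 ∷ #2 ∷ #3 ∷ #2 ∷ #1 ∷ #2 ∷ #3 ∷ #4 ∷ #0 ∷ #1 ∷ #2 ∷ #1 ∷ #0 ∷ #1 ∷ #2 ∷ #3 ∷ #4 ∷ #3 ∷ #2 ∷ #1 ∷ #2 ∷ #3 ∷ #4 ∷ []

g₁ : Σ₅ → List Bin
g₁ #0 = b0 ∷ b1 ∷ b1 ∷ b1 ∷ b0 ∷ b0 ∷ []
g₁ #1 = b1 ∷ b0 ∷ b1 ∷ b1 ∷ b0 ∷ b0 ∷ []
g₁ #2 = b1 ∷ b1 ∷ b1 ∷ b0 ∷ b0 ∷ b0 ∷ []
g₁ #3 = b1 ∷ b1 ∷ b0 ∷ b0 ∷ b1 ∷ b0 ∷ []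
g₁ #4 = b1 ∷ b1 ∷ b0 ∷ b0 ∷ b0 ∷ b1 ∷ []

hw : List Σ₅ → List Σ₅
hw = concatMap h

g : List Σ₅ → List Bin
g = concatMap g₁

hpow : ℕ → List Σ₅ → List Σ₅
hpow zero w = w
hpow (suc m) w = hw (hpow m w)

h'₁ : Σ₅ → List (List Σ₅)
h'₁ #0 = h #0 ∷ (#0 ∷ #1 ∷ #2 ∷ #1 ∷ #0 ∷ #1 ∷ #2 ∷ #3 ∷ #2 ∷ #1 ∷ #2 ∷ #3 ∷ #4 ∷ #0 ∷ #1 ∷ #2 ∷ #3 ∷ #4 ∷ #3 ∷ #2 ∷ #1 ∷ #2 ∷ #3 ∷ #4 ∷ []) ∷ []
h'₁ a = h a ∷ []

data InH' : List Σ₅ → List Σ₅ → Set where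
  nil  : InH' [] []
  cons : ∀ {a w u v} → u ∈ h'₁ a → InH' w v → InH' (a ∷ w) (u ++ v)

InGH' : List Σ₅ → List Bin → Set
InGH' w y = ∃ λ u → InH' w u × y ≡ g u

OnlyAllowedSquares : List Bin → Set
OnlyAllowedSquares y =
  ∀ (p x s : List Bin) → ¬ (x ≡ []) → y ≡ p ++ (x ++ x) ++ s →
  (x ++ x ≡ b0 ∷ b0 ∷ []) ⊎ ((x ++ x ≡ b1 ∷ b1 ∷ []) ⊎ (x ++ x ≡ b0 ∷ b1 ∷ b0 ∷ b1 ∷ []))

-- Squares are controlled by a synchronisation test for uniform substitutions f (all blocks f(a) have
-- the same length L, blocks of distinct letters differ), run for h′ (L = 24) and then for g (L = 6).
-- The invariant is admissibility: square-freeness plus a local condition (consecutive letters are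
-- edges of a graph on Σ₅, and 010, 434 do not occur), which h′ preserves, so h^m(0) has it.  Let u be
-- admissible and xx a factor of an image y of u.  Blocks outside the square are discarded until it
-- starts and ends within one block of the ends of y.  If u is short the square is inspected directly.
-- Otherwise |x| ≥ L + K, and since no factor of length K at a nonzero offset inside a block begins an
-- image, |x| is a multiple of L: both copies of x start at the same offset r in their blocks.  For
-- r = 0 the square lifts to a square of u.  For r > 0 the letters a, b, c of u whose blocks contain the
-- positions |p|, |p| + |x|, |p| + 2|x| satisfy a boundary condition forcing u = ⋯a M b M c⋯ to contain
-- a square or to break the local condition.  The finite conditions are decided by evaluation.
-- Finally h′(w) offers two blocks at each letter 0 of w = h(h^(m-1)(0)), every h(a) contains at least
-- three 0s, and g is injective, which yields at least 2^(3·24^(m-1)) distinct words.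
module Submission where

open import Defs
open import Data.Bool using (Bool; true; false; T; _∧_; not)
open import Data.Bool.Properties using (T-∧)
open import Data.Empty using (⊥; ⊥-elim)
import Data.Fin.Properties as Fin
open import Data.List
  using (List; []; _∷_; [_]; _++_; length; take; drop; map; upTo; applyUpTo; filter; cartesianProductWith; allFin)
open import Data.List.Properties
  using (++-assoc; ++-identityʳ; ++-cancelˡ; ++-conicalˡ; ++-conicalʳ; ∷-injective; ∷-injectiveʳ; length-++;
         length-++-≤ˡ; length-++-≤ʳ; length-map; length-take; length-drop; map-++; take-take; take-[]; drop-[];
         drop-drop; take++drop≡id; ≡-dec)
open import Data.List.Membership.Propositional using (_∈_)
open import Data.List.Membership.Propositional.Properties
  using (∈-map⁻; ∈-upTo⁺; ∈-applyUpTo⁺; ∈-applyUpTo⁻; ∈-filter⁺; ∈-allFin;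
         ∈-cartesianProductWith⁺; ∈-cartesianProductWith⁻)
open import Data.List.Relation.Unary.All as All using (All; []; _∷_)
import Data.List.Relation.Unary.All.Properties as All
open import Data.List.Relation.Unary.AllPairs using ([]; _∷_)
open import Data.List.Relation.Unary.Any using (here)
open import Data.List.Relation.Unary.Unique.Propositional using (Unique)
import Data.List.Relation.Unary.Unique.Propositional.Properties as Unique
open import Data.List.Relation.Unary.Unique.DecPropositional (≡-dec (Fin._≟_ {5})) using (unique?)
open import Data.Nat
  using (ℕ; zero; suc; _+_; _*_; _∸_; _^_; _/_; _%_; _≤_; _<_; _≤?_; _<?_; s≤s; z≤n; NonZero; >-nonZero⁻¹; ≢-nonZero⁻¹)
open import Data.Nat using () renaming (_≟_ to _≟ℕ_)
open import Data.Nat.Divisibility using (_∣_; divides; ∣m+n∣m⇒∣n)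
open import Data.Nat.DivMod using (m≡m%n+[m/n]*n; m%n<n; m*n/n≡m)
open import Data.Nat.ListAction using (product)
open import Data.Nat.ListAction.Properties using (product-++)
open import Data.Nat.Properties
open import Data.Nat.Tactic.RingSolver using (solve-∀)
open import Data.Product using (Σ-syntax; ∃; ∃-syntax; _×_; _,_; proj₁; proj₂)
open import Data.Sum using (_⊎_; inj₁; inj₂)
open import Function using (_∘_; Equivalence)
open import Relation.Binary.Definitions using (DecidableEquality)
open import Relation.Binary.PropositionalEquality hiding ([_])
open import Relation.Nullary using (¬_; Dec; yes; no)
open import Relation.Nullary.Decidable using (map′; from-yes; T?; ¬?; _×-dec_; _⊎-dec_; _→-dec_)
open import Relation.Unary using (Decidable)

module _ {A : Set} where

  ++-cancel-length : ∀ (a b : List A) {c d} → length a ≡ length b → a ++ c ≡ b ++ d → a ≡ b × c ≡ d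
  ++-cancel-length []      []      _   eq = refl , eq
  ++-cancel-length (x ∷ a) (y ∷ b) len eq with refl , eq′ ← ∷-injective eq
    with refl , refl ← ++-cancel-length a b (suc-injective len) eq′ = refl , refl

  levi : ∀ (a c : List A) {b d} → a ++ b ≡ c ++ d → length a ≤ length c → ∃[ e ] c ≡ a ++ e × b ≡ e ++ d
  levi []      c       eq _         = c , refl , eq
  levi (x ∷ a) (y ∷ c) eq (s≤s a≤c) with refl , eq′ ← ∷-injective eq
    with e , refl , refl ← levi a c eq′ a≤c = e , refl , refl

  take-length-++ : ∀ (a b : List A) → take (length a) (a ++ b) ≡ a
  take-length-++ []      b = refl
  take-length-++ (x ∷ a) b = cong (x ∷_) (take-length-++ a b)

  drop-length-++ : ∀ (a b : List A) → drop (length a) (a ++ b) ≡ b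
  drop-length-++ []      b = refl
  drop-length-++ (x ∷ a) b = drop-length-++ a b

  take-++-length : ∀ {n} (a b : List A) → length a ≡ n → take n (a ++ b) ≡ a
  take-++-length a b refl = take-length-++ a b

  drop-++-length : ∀ {n} (a b : List A) → length a ≡ n → drop n (a ++ b) ≡ b
  drop-++-length a b refl = drop-length-++ a b

  take-++-+ : ∀ {k} (a b : List A) n → length a ≡ k → take (k + n) (a ++ b) ≡ a ++ take n b
  take-++-+ []      b n refl = refl
  take-++-+ (x ∷ a) b n refl = cong (x ∷_) (take-++-+ a b n refl)

  drop-++-+ : ∀ {k} (a b : List A) n → length a ≡ k → drop (k + n) (a ++ b) ≡ drop n b
  drop-++-+ []      b n refl = refl
  drop-++-+ (x ∷ a) b n refl = drop-++-+ a b n refl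

  take-++-≤ : ∀ {k} (a b : List A) → k ≤ length a → take k (a ++ b) ≡ take k a
  take-++-≤ {zero}  a       b _         = refl
  take-++-≤ {suc k} (x ∷ a) b (s≤s k≤a) = cong (x ∷_) (take-++-≤ a b k≤a)

  take-drop-++ : ∀ j {k} (a b : List A) → j + k ≤ length a → take k (drop j (a ++ b)) ≡ take k (drop j a)
  take-drop-++ zero    a       b k≤a         = take-++-≤ a b k≤a
  take-drop-++ (suc j) (x ∷ a) b (s≤s j+k≤a) = take-drop-++ j a b j+k≤a

  take-take-≤ : ∀ {k n} (a : List A) → k ≤ n → take k (take n a) ≡ take k a
  take-take-≤ {k} {n} a k≤n = trans (take-take k n a) (cong (λ i → take i a) (m≤n⇒m⊓n≡m k≤n))

  take-drop-take : ∀ j {k n} (a : List A) → j + k ≤ n → take k (drop j (take n a)) ≡ take k (drop j a)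
  take-drop-take zero              a       k≤n         = take-take-≤ a k≤n
  take-drop-take (suc j) {n = suc n} []      _           = refl
  take-drop-take (suc j) {n = suc n} (x ∷ a) (s≤s j+k≤n) = take-drop-take j a j+k≤n

  length-take-≤ : ∀ n (a : List A) → length (take n a) ≤ n
  length-take-≤ n a = subst (_≤ n) (sym (length-take n a)) (m⊓n≤m n (length a))

  length-square : ∀ (p x s : List A) →
    length (p ++ (x ++ x) ++ s) ≡ length p + ((length x + length x) + length s)
  length-square p x s =
    trans (length-++ p) (cong (length p +_) (trans (length-++ (x ++ x)) (cong (_+ length s) (length-++ x))))

  take-drop-square : ∀ (p x s : List A) {j k} → j + k ≤ length x →
    take k (drop (length p + j) (p ++ (x ++ x) ++ s)) ≡ take k (drop (length p + length x + j) (p ++ (x ++ x) ++ s))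
  take-drop-square p x s {j} {k} j+k≤x = begin
    take k (drop (length p + j) (p ++ (x ++ x) ++ s))              ≡⟨ cong (take k) (drop-++-+ p _ j refl) ⟩
    take k (drop j ((x ++ x) ++ s))                                ≡⟨ cong (λ z → take k (drop j z)) (++-assoc x x s) ⟩
    take k (drop j (x ++ x ++ s))                                  ≡⟨ take-drop-++ j x (x ++ s) j+k≤x ⟩
    take k (drop j x)                                              ≡⟨ take-drop-++ j x s j+k≤x ⟨
    take k (drop j (x ++ s))                                       ≡⟨ cong (take k) (drop-++-+ x (x ++ s) j refl) ⟨
    take k (drop (length x + j) (x ++ x ++ s))                     ≡⟨ cong (λ z → take k (drop (length x + j) z)) (++-assoc x x s) ⟨
    take k (drop (length x + j) ((x ++ x) ++ s))                   ≡⟨ cong (take k) (drop-++-+ p _ (length x + j) refl) ⟨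
    take k (drop (length p + (length x + j)) (p ++ (x ++ x) ++ s)) ≡⟨ cong (λ i → take k (drop i (p ++ (x ++ x) ++ s))) (+-assoc (length p) (length x) j) ⟨
    take k (drop (length p + length x + j) (p ++ (x ++ x) ++ s))   ∎
    where open ≡-Reasoning

  square-halves : ∀ (x s : List A) →
    take (length x) ((x ++ x) ++ s) ≡ x × take (length x) (drop (length x) ((x ++ x) ++ s)) ≡ x
  square-halves x s =
    trans (cong (take (length x)) (++-assoc x x s)) (take-length-++ x (x ++ s)) ,
    trans (cong (λ z → take (length x) (drop (length x) z)) (++-assoc x x s))
      (trans (cong (take (length x)) (drop-length-++ x (x ++ s))) (take-length-++ x s))

  square-prefix : ∀ k (v : List A) → take k v ≡ take k (drop k v) → v ≡ (take k v ++ take k v) ++ drop k (drop k v)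
  square-prefix k v eq = begin
    v                                                     ≡⟨ take++drop≡id k v ⟨
    take k v ++ drop k v                                  ≡⟨ cong (take k v ++_) (take++drop≡id k (drop k v)) ⟨
    take k v ++ take k (drop k v) ++ drop k (drop k v)    ≡⟨ cong (λ z → take k v ++ z ++ drop k (drop k v)) eq ⟨
    take k v ++ take k v ++ drop k (drop k v)             ≡⟨ ++-assoc (take k v) _ _ ⟨
    (take k v ++ take k v) ++ drop k (drop k v)           ∎
    where open ≡-Reasoning

module _ {A B C : Set} where

  length-cartesianProductWith : ∀ (f : A → B → C) xs ys →
    length (cartesianProductWith f xs ys) ≡ length xs * length ys
  length-cartesianProductWith f []       ys = refl
  length-cartesianProductWith f (x ∷ xs) ys =
    trans (length-++ (map (f x) ys)) (cong₂ _+_ (length-map (f x) ys) (length-cartesianProductWith f xs ys))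

module _ {A : Set} where

  Unique-cartesianProduct-++ : ∀ {n} (xs ys : List (List A)) → All (λ x → length x ≡ n) xs →
    Unique xs → Unique ys → Unique (cartesianProductWith _++_ xs ys)
  Unique-cartesianProduct-++ []       ys _          _          _   = []
  Unique-cartesianProduct-++ (x ∷ xs) ys (x≡ ∷ xs≡) (x∉ ∷ uxs) uys =
    Unique.++⁺ (Unique.map⁺ (++-cancelˡ x _ _) uys) (Unique-cartesianProduct-++ xs ys xs≡ uxs uys) disjoint
    where
      disjoint : ∀ {v} → ¬ (v ∈ map (x ++_) ys × v ∈ cartesianProductWith _++_ xs ys)
      disjoint (v∈₁ , v∈₂) with _ , _ , refl ← ∈-map⁻ (x ++_) v∈₁
        with x′ , _ , x′∈ , _ , eq ← ∈-cartesianProductWith⁻ _++_ xs ys v∈₂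
        = All.lookup x∉ x′∈ (proj₁ (++-cancel-length x x′ (trans x≡ (sym (All.lookup xs≡ x′∈))) eq))

-- Squares

module _ {A : Set} where

  AllSquares : (List A → Set) → List A → Set
  AllSquares P y = ∀ p x s → x ≢ [] → y ≡ p ++ (x ++ x) ++ s → P (x ++ x)

  SquareFree : List A → Set
  SquareFree = AllSquares (λ _ → ⊥)

  SquareFree-++⁻ˡ : ∀ a b → SquareFree (a ++ b) → SquareFree a
  SquareFree-++⁻ˡ a b sf p x s x≢[] refl =
    sf p x (s ++ b) x≢[] (trans (++-assoc p _ b) (cong (p ++_) (++-assoc (x ++ x) s b)))

  SquareFree-++⁻ʳ : ∀ a b → SquareFree (a ++ b) → SquareFree b
  SquareFree-++⁻ʳ a b sf p x s x≢[] refl = sf (a ++ p) x s x≢[] (sym (++-assoc a p _))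

  NoSquarePrefix : List A → Set
  NoSquarePrefix v = All (λ k → take k v ≢ take k (drop k v)) (applyUpTo suc (length v))

  SquareFree⇒NoSquarePrefix : ∀ v → SquareFree v → NoSquarePrefix v
  SquareFree⇒NoSquarePrefix v sf = All.tabulate λ k∈ → no-square (∈-applyUpTo⁻ suc k∈)
    where
      no-square : ∀ {k} → ∃[ i ] i < length v × k ≡ suc i → take k v ≢ take k (drop k v)
      no-square (i , i<v , refl) eq = sf [] (take (suc i) v) _ (take-suc≢[] v i<v) (square-prefix (suc i) v eq)
        where
          take-suc≢[] : ∀ v → i < length v → take (suc i) v ≢ []
          take-suc≢[] (_ ∷ _) _ ()

  SquareFree-∷ : ∀ a w → NoSquarePrefix (a ∷ w) → SquareFree w → SquareFree (a ∷ w)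
  SquareFree-∷ a w nsp sf []      []         s x≢[] eq = x≢[] refl
  SquareFree-∷ a w nsp sf []      x@(_ ∷ _) s x≢[] eq =
    All.lookup (subst NoSquarePrefix eq nsp) (∈-applyUpTo⁺ suc (≤-trans (length-++-≤ˡ x) (length-++-≤ˡ (x ++ x))))
      (trans (proj₁ (square-halves x s)) (sym (proj₂ (square-halves x s))))
  SquareFree-∷ a w nsp sf (b ∷ p) x         s x≢[] eq = sf p x s x≢[] (∷-injectiveʳ eq)

  squareFree? : DecidableEquality A → Decidable SquareFree
  squareFree? _≟_ []      = yes λ p x s x≢[] eq → x≢[] (++-conicalˡ x x (++-conicalˡ _ s (++-conicalʳ p _ (sym eq))))
  squareFree? _≟_ (a ∷ w) = map′ (λ (nsp , sf) → SquareFree-∷ a w nsp sf)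
    (λ sf → SquareFree⇒NoSquarePrefix _ sf , SquareFree-++⁻ʳ [ a ] w sf)
    (All.all? (λ k → ¬? (≡-dec _≟_ (take k (a ∷ w)) (take k (drop k (a ∷ w))))) _ ×-dec squareFree? _≟_ w)

-- Admissible words

edge : Σ₅ → Σ₅ → Bool
edge #0 #1 = true
edge #1 #0 = true
edge #1 #2 = true
edge #2 #1 = true
edge #2 #3 = true
edge #3 #2 = true
edge #3 #4 = true
edge #4 #0 = true
edge #4 #3 = true
edge _  _  = false

excluded : Σ₅ → Σ₅ → Σ₅ → Bool
excluded #0 #1 #0 = true
excluded #4 #3 #4 = true
excluded _  _  _  = false

Edge : Σ₅ → Σ₅ → Set
Edge a b = T (edge a b)

allowedBefore : Σ₅ → List Σ₅ → Bool
allowedBefore a []          = true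
allowedBefore a (b ∷ [])    = edge a b
allowedBefore a (b ∷ c ∷ _) = edge a b ∧ edge b c ∧ not (excluded a b c)

data LocallyAdmissible : List Σ₅ → Set where
  []  : LocallyAdmissible []
  _∷_ : ∀ {a w} → T (allowedBefore a w) → LocallyAdmissible w → LocallyAdmissible (a ∷ w)

allowedBefore⇒Edge : ∀ a b w → T (allowedBefore a (b ∷ w)) → Edge a b
allowedBefore⇒Edge a b []      e = e
allowedBefore⇒Edge a b (c ∷ w) t = proj₁ (Equivalence.to T-∧ t)

allowedBefore-++⁻ˡ : ∀ a w v → T (allowedBefore a (w ++ v)) → T (allowedBefore a w)
allowedBefore-++⁻ˡ a []          v       _ = _
allowedBefore-++⁻ˡ a (b ∷ [])    []      t = t
allowedBefore-++⁻ˡ a (b ∷ [])    (c ∷ v) t = allowedBefore⇒Edge a b (c ∷ v) t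
allowedBefore-++⁻ˡ a (b ∷ c ∷ w) v       t = t

allowedBefore-++ : ∀ a w v → 2 ≤ length w → allowedBefore a (w ++ v) ≡ allowedBefore a w
allowedBefore-++ a (b ∷ [])    v (s≤s ())
allowedBefore-++ a (b ∷ c ∷ w) v _ = refl

LocallyAdmissible⇒Edge : ∀ {a b w} → LocallyAdmissible (a ∷ b ∷ w) → Edge a b
LocallyAdmissible⇒Edge {a} {b} {w} (t ∷ _) = allowedBefore⇒Edge a b w t

LocallyAdmissible-++⁻ˡ : ∀ w v → LocallyAdmissible (w ++ v) → LocallyAdmissible w
LocallyAdmissible-++⁻ˡ []      v _        = []
LocallyAdmissible-++⁻ˡ (a ∷ w) v (t ∷ la) = allowedBefore-++⁻ˡ a w v t ∷ LocallyAdmissible-++⁻ˡ w v la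

LocallyAdmissible-++⁻ʳ : ∀ w v → LocallyAdmissible (w ++ v) → LocallyAdmissible v
LocallyAdmissible-++⁻ʳ []      v la       = la
LocallyAdmissible-++⁻ʳ (a ∷ w) v (_ ∷ la) = LocallyAdmissible-++⁻ʳ w v la

-- the windows of width three overlapping the seam all lie inside w ++ v or v ++ r
LocallyAdmissible-glue : ∀ w v r → 2 ≤ length v →
  LocallyAdmissible (w ++ v) → LocallyAdmissible (v ++ r) → LocallyAdmissible (w ++ v ++ r)
LocallyAdmissible-glue []      v r _   _        lv = lv
LocallyAdmissible-glue (a ∷ w) v r 2≤v (t ∷ la) lv =
  subst T (sym (trans (cong (allowedBefore a) (sym (++-assoc w v r))) (allowedBefore-++ a (w ++ v) r 2≤wv))) t
  ∷ LocallyAdmissible-glue w v r 2≤v la lv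
  where
    2≤wv : 2 ≤ length (w ++ v)
    2≤wv = ≤-trans 2≤v (length-++-≤ʳ v {w})

locallyAdmissible? : Decidable LocallyAdmissible
locallyAdmissible? []      = yes []
locallyAdmissible? (a ∷ w) = map′ (λ (t , la) → t ∷ la) (λ { (t ∷ la) → t , la })
                                  (T? (allowedBefore a w) ×-dec locallyAdmissible? w)

Admissible : List Σ₅ → Set
Admissible w = SquareFree w × LocallyAdmissible w

Admissible-++⁻ˡ : ∀ w v → Admissible (w ++ v) → Admissible w
Admissible-++⁻ˡ w v (sf , la) = SquareFree-++⁻ˡ w v sf , LocallyAdmissible-++⁻ˡ w v la

Admissible-++⁻ʳ : ∀ w v → Admissible (w ++ v) → Admissible v
Admissible-++⁻ʳ w v (sf , la) = SquareFree-++⁻ʳ w v sf , LocallyAdmissible-++⁻ʳ w v la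

Admissible-take : ∀ n w → Admissible w → Admissible (take n w)
Admissible-take n w adm = Admissible-++⁻ˡ (take n w) (drop n w) (subst Admissible (sym (take++drop≡id n w)) adm)

Admissible-drop : ∀ n w → Admissible w → Admissible (drop n w)
Admissible-drop n w adm = Admissible-++⁻ʳ (take n w) (drop n w) (subst Admissible (sym (take++drop≡id n w)) adm)

admissible? : Decidable Admissible
admissible? w = squareFree? Fin._≟_ w ×-dec locallyAdmissible? w

admissibleWords : ℕ → List (List Σ₅)
admissibleWords zero    = [ [] ]
admissibleWords (suc n) = filter admissible? (cartesianProductWith _∷_ (allFin 5) (admissibleWords n))

∈-admissibleWords : ∀ {w} → Admissible w → w ∈ admissibleWords (length w)
∈-admissibleWords {[]}    _   = here refl
∈-admissibleWords {a ∷ w} adm = ∈-filter⁺ admissible?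
  (∈-cartesianProductWith⁺ _∷_ (∈-allFin a) (∈-admissibleWords (Admissible-++⁻ʳ [ a ] w adm))) adm

AllAdmissibleUpTo : ℕ → (List Σ₅ → Set) → Set
AllAdmissibleUpTo d P = All (λ n → All P (admissibleWords n)) (upTo (suc d))

allAdmissibleUpTo? : ∀ d {P} → Decidable P → Dec (AllAdmissibleUpTo d P)
allAdmissibleUpTo? d P? = All.all? (λ n → All.all? P? (admissibleWords n)) (upTo (suc d))

lookup-admissible : ∀ {d P w} → AllAdmissibleUpTo d P → Admissible w → length w ≤ d → P w
lookup-admissible all adm w≤d = All.lookup (All.lookup all (∈-upTo⁺ (s≤s w≤d))) (∈-admissibleWords adm)

Framable : Σ₅ → Σ₅ → Σ₅ → Set
Framable a b c = (Edge a b × Edge b c) ⊎ ∃[ m ] Edge a m × Edge b m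

framable? : ∀ a b c → Dec (Framable a b c)
framable? a b c = (T? (edge a b) ×-dec T? (edge b c)) ⊎-dec Fin.any? (λ m → T? (edge a m) ×-dec T? (edge b m))

LocallyAdmissible⇒Framable : ∀ a b c M → LocallyAdmissible (a ∷ M ++ b ∷ M ++ [ c ]) → Framable a b c
LocallyAdmissible⇒Framable a b c []      la =
  inj₁ (LocallyAdmissible⇒Edge la , LocallyAdmissible⇒Edge (LocallyAdmissible-++⁻ʳ [ a ] (b ∷ [ c ]) la))
LocallyAdmissible⇒Framable a b c (m ∷ M) la =
  inj₂ (m , LocallyAdmissible⇒Edge la , LocallyAdmissible⇒Edge (LocallyAdmissible-++⁻ʳ (a ∷ m ∷ M) _ la))

¬framed : ∀ {a b c} M → Admissible (a ∷ M ++ b ∷ M ++ [ c ]) →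
  a ≡ b ⊎ b ≡ c ⊎ ¬ Framable a b c → ⊥
¬framed {a} {c = c} M (sf , _) (inj₁ refl) =
  sf [] (a ∷ M) [ c ] (λ ()) (cong (a ∷_) (sym (++-assoc M (a ∷ M) [ c ])))
¬framed {a} {b} M (sf , _) (inj₂ (inj₁ refl)) =
  sf [ a ] (M ++ [ b ]) [] (snoc≢[] M) (cong (a ∷_) (sym (trans (++-identityʳ _) (++-assoc M [ b ] (M ++ [ b ])))))
  where
    snoc≢[] : ∀ M → M ++ [ b ] ≢ []
    snoc≢[] []      ()
    snoc≢[] (_ ∷ _) ()
¬framed {a} {b} {c} M (_ , la) (inj₂ (inj₂ ¬framable)) = ¬framable (LocallyAdmissible⇒Framable a b c M la)

-- Uniform substitutions

module Substitution {A X : Set} (f : A → List (List X)) where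

  data Image : List A → List X → Set where
    []  : Image [] []
    _∷_ : ∀ {a w u v} → u ∈ f a → Image w v → Image (a ∷ w) (u ++ v)

  Image-[] : ∀ {y} → Image [] y → y ≡ []
  Image-[] [] = refl

  images : List A → List (List X)
  images []      = [ [] ]
  images (a ∷ w) = cartesianProductWith _++_ (f a) (images w)

  Image⇒∈images : ∀ {w y} → Image w y → y ∈ images w
  Image⇒∈images []      = here refl
  Image⇒∈images (u∈ ∷ i) = ∈-cartesianProductWith⁺ _++_ u∈ (Image⇒∈images i)

  ∈images⇒Image : ∀ w {y} → y ∈ images w → Image w y
  ∈images⇒Image []      (here refl) = []
  ∈images⇒Image (a ∷ w) y∈ with _ , _ , u∈ , v∈ , refl ← ∈-cartesianProductWith⁻ _++_ (f a) (images w) y∈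
    = u∈ ∷ ∈images⇒Image w v∈

  length-images : ∀ w → length (images w) ≡ product (map (length ∘ f) w)
  length-images []      = refl
  length-images (a ∷ w) =
    trans (length-cartesianProductWith _++_ (f a) (images w)) (cong (length (f a) *_) (length-images w))

  module OfLength (L : ℕ) .{{_ : NonZero L}} (uniform : ∀ {a u} → u ∈ f a → length u ≡ L) where

    block≢[] : ∀ {a u} → u ∈ f a → u ≢ []
    block≢[] u∈ refl = ≢-nonZero⁻¹ L (sym (uniform u∈))

    length-Image : ∀ {w y} → Image w y → length y ≡ length w * L
    length-Image []                 = refl
    length-Image (_∷_ {u = u} u∈ i) = trans (length-++ u) (cong₂ _+_ (uniform u∈) (length-Image i))

    Image-empty : ∀ {w y} → Image w y → y ≡ [] → w ≡ []
    Image-empty []                       _  = refl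
    Image-empty (_∷_ {u = u} {v = v} u∈ _) eq = ⊥-elim (block≢[] u∈ (++-conicalˡ u v eq))

    take-Image : ∀ n {w y} → Image w y → Image (take n w) (take (n * L) y)
    take-Image zero    _  = []
    take-Image (suc n) [] = subst (Image []) (sym (take-[] (suc n * L))) []
    take-Image (suc n) (_∷_ {u = u} {v = v} u∈ i) =
      subst (Image _) (sym (take-++-+ u v (n * L) (uniform u∈))) (u∈ ∷ take-Image n i)

    drop-Image : ∀ n {w y} → Image w y → Image (drop n w) (drop (n * L) y)
    drop-Image zero    i  = i
    drop-Image (suc n) [] = subst (Image []) (sym (drop-[] (suc n * L))) []
    drop-Image (suc n) (_∷_ {u = u} {v = v} u∈ i) =
      subst (Image _) (sym (drop-++-+ u v (n * L) (uniform u∈))) (drop-Image n i)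

    Image-take-prefix : ∀ n {w y z t} → Image w y → y ≡ z ++ t → length z ≡ n * L → Image (take n w) z
    Image-take-prefix n {z = z} {t} img refl z≡ =
      subst (Image _) (take-++-length z t z≡) (take-Image n img)

    Image-single : ∀ {w y} → Image w y → y ≢ [] → length y < L + L → ∃[ a ] w ≡ [ a ] × y ∈ f a
    Image-single []                              y≢[] _ = ⊥-elim (y≢[] refl)
    Image-single (_∷_ {a = a} {u = u} u∈ [])     _    _ = a , refl , subst (_∈ f a) (sym (++-identityʳ u)) u∈
    Image-single (_∷_ {u = u} u∈ (_∷_ {u = u′} {v = v} u′∈ _)) _ y<2L = ⊥-elim (<⇒≱ y<2L (begin
      L + L                     ≤⟨ +-monoʳ-≤ L (m≤m+n L (length v)) ⟩
      L + (L + length v)        ≡⟨ cong₂ (λ k k′ → k + (k′ + length v)) (uniform u∈) (uniform u′∈) ⟨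
      length u + (length u′ + length v) ≡⟨ cong (length u +_) (length-++ u′) ⟨
      length u + length (u′ ++ v) ≡⟨ length-++ u ⟨
      length (u ++ u′ ++ v)     ∎))
      where open ≤-Reasoning

    Unique-images : (∀ a → Unique (f a)) → ∀ w → Unique (images w)
    Unique-images unique []      = [] ∷ []
    Unique-images unique (a ∷ w) =
      Unique-cartesianProduct-++ (f a) (images w) (All.tabulate uniform) (unique a) (Unique-images unique w)

    module Injective (distinct : ∀ {a b u} → u ∈ f a → u ∈ f b → a ≡ b) where

      Image-prefix : ∀ {w w′ z t y} → Image w z → Image w′ y → y ≡ z ++ t → ∃[ w″ ] w′ ≡ w ++ w″ × Image w″ t
      Image-prefix [] i′ refl = _ , refl , i′
      Image-prefix {t = t} (_∷_ {u = u} {v = v} u∈ _) [] eq =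
        ⊥-elim (block≢[] u∈ (++-conicalˡ u v (++-conicalˡ (u ++ v) t (sym eq))))
      Image-prefix {t = t} (_∷_ {u = u} {v = v} u∈ i) (_∷_ {u = u′} u′∈ i′) eq
        with refl , eq′ ← ++-cancel-length u′ u (trans (uniform u′∈) (sym (uniform u∈))) (trans eq (++-assoc u v t))
        with refl ← distinct u′∈ u∈
        with w″ , refl , i″ ← Image-prefix i i′ eq′ = w″ , refl , i″

      Image-injective : ∀ {w w′ y} → Image w y → Image w′ y → w ≡ w′
      Image-injective {w} {y = y} i i′ with w″ , refl , i″ ← Image-prefix i i′ (sym (++-identityʳ y))
        = sym (trans (cong (w ++_) (Image-empty i″ refl)) (++-identityʳ w))

-- The square test

module SquareTest {X : Set} (f : Σ₅ → List (List X)) (L : ℕ) .{{_ : NonZero L}} (Good : List X → Set) where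

  open Substitution f

  Uniform : Set
  Uniform = ∀ a → All (λ u → length u ≡ L) (f a)

  Distinct : Set
  Distinct = ∀ a b → All (λ u → All (λ v → u ≡ v → a ≡ b) (f b)) (f a)

  Boundary : Set
  Boundary = ∀ a b c → All (λ u → All (λ v → All (λ w → All (λ r →
    drop r u ≡ drop r v → take r v ≡ take r w → a ≡ b ⊎ b ≡ c ⊎ ¬ Framable a b c)
    (upTo L)) (f c)) (f b)) (f a)

  Synchronizing : ℕ → ℕ → ℕ → Set
  Synchronizing K d d′ = AllAdmissibleUpTo d λ v → All (λ y → All (λ r → 1 ≤ r → r + K ≤ length y →
    AllAdmissibleUpTo d′ λ v′ → All (λ y′ → take K (drop r y) ≢ take K y′) (images v′))
    (upTo L)) (images v)

  PrefixSquareGood : List X → ℕ → Set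
  PrefixSquareGood r t = 0 < t → t / 2 + t / 2 ≡ t → take (t / 2) r ≡ take (t / 2) (drop (t / 2) r) → Good (take t r)

  TightSquaresGood : List X → Set
  TightSquaresGood y = All (λ i → All (λ j → PrefixSquareGood (drop i y) (length (drop i y) ∸ j)) (upTo L)) (upTo L)

  SmallImagesGood : ℕ → Set
  SmallImagesGood c = AllAdmissibleUpTo c λ u → All TightSquaresGood (images u)

  module Decide (_≟_ : DecidableEquality X) (good? : Decidable Good) where

    _≟ₗ_ : DecidableEquality (List X)
    _≟ₗ_ = ≡-dec _≟_

    uniform? : Dec Uniform
    uniform? = Fin.all? λ a → All.all? (λ u → length u ≟ℕ L) (f a)

    distinct? : Dec Distinct
    distinct? = Fin.all? λ a → Fin.all? λ b →
      All.all? (λ u → All.all? (λ v → (u ≟ₗ v) →-dec (a Fin.≟ b)) (f b)) (f a)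

    boundary? : Dec Boundary
    boundary? = Fin.all? λ a → Fin.all? λ b → Fin.all? λ c →
      All.all? (λ u → All.all? (λ v → All.all? (λ w → All.all? (λ r →
        (drop r u ≟ₗ drop r v) →-dec (take r v ≟ₗ take r w) →-dec
        ((a Fin.≟ b) ⊎-dec (b Fin.≟ c) ⊎-dec ¬? (framable? a b c)))
      (upTo L)) (f c)) (f b)) (f a)

    synchronizing? : ∀ K d d′ → Dec (Synchronizing K d d′)
    synchronizing? K d d′ = allAdmissibleUpTo? d λ v → All.all? (λ y → All.all? (λ r →
      (1 ≤? r) →-dec (r + K ≤? length y) →-dec allAdmissibleUpTo? d′ λ v′ →
        All.all? (λ y′ → ¬? (take K (drop r y) ≟ₗ take K y′)) (images v′))
      (upTo L)) (images v)

    prefixSquareGood? : ∀ r t → Dec (PrefixSquareGood r t)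
    prefixSquareGood? r t =
      (0 <? t) →-dec (t / 2 + t / 2 ≟ℕ t) →-dec (take (t / 2) r ≟ₗ take (t / 2) (drop (t / 2) r)) →-dec good? (take t r)

    tightSquaresGood? : Decidable TightSquaresGood
    tightSquaresGood? y = All.all? (λ i → tight (drop i y)) (upTo L)
      where
        -- length r is passed as an argument so that it is evaluated only once
        tight : ∀ r → Dec (All (λ j → PrefixSquareGood r (length r ∸ j)) (upTo L))
        tight r = go (length r)
          where
            go : ∀ n → Dec (All (λ j → PrefixSquareGood r (n ∸ j)) (upTo L))
            go n = All.all? (λ j → prefixSquareGood? r (n ∸ j)) (upTo L)

    smallImagesGood? : ∀ c → Dec (SmallImagesGood c)
    smallImagesGood? c = allAdmissibleUpTo? c λ u → All.all? tightSquaresGood? (images u)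

  PrefixSquareGood-sound : ∀ x s → x ≢ [] → PrefixSquareGood ((x ++ x) ++ s) (length (x ++ x)) → Good (x ++ x)
  PrefixSquareGood-sound []        s x≢[] _    = ⊥-elim (x≢[] refl)
  PrefixSquareGood-sound x@(_ ∷ _) s _    good = subst Good (take-length-++ (x ++ x) s)
    (good (s≤s z≤n) (subst (λ k → k + k ≡ length (x ++ x)) (sym half≡) (sym (length-++ x)))
      (subst (λ k → take k ((x ++ x) ++ s) ≡ take k (drop k ((x ++ x) ++ s))) (sym half≡)
        (trans (proj₁ (square-halves x s)) (sym (proj₂ (square-halves x s))))))
    where
      half≡ : length (x ++ x) / 2 ≡ length x
      half≡ = trans (cong (_/ 2) (trans (length-++ x) (double (length x)))) (m*n/n≡m (length x) 2)
        where
          double : ∀ ℓ → ℓ + ℓ ≡ ℓ * 2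
          double = solve-∀

  TightSquaresGood-sound : ∀ {y p x s} → TightSquaresGood y → y ≡ p ++ (x ++ x) ++ s →
    length p < L → length s < L → x ≢ [] → Good (x ++ x)
  TightSquaresGood-sound {p = p} {x} {s} good refl p<L s<L x≢[] = PrefixSquareGood-sound x s x≢[]
    (subst (PrefixSquareGood r) (trans (cong (_∸ length s) (length-++ (x ++ x))) (m+n∸n≡m _ (length s)))
      (subst (λ r → PrefixSquareGood r (length r ∸ length s)) (drop-length-++ p r)
        (All.lookup (All.lookup good (∈-upTo⁺ p<L)) (∈-upTo⁺ s<L))))
    where r = (x ++ x) ++ s

  round-up : ∀ t → ∃[ k ] ∃[ j ] t + j ≡ k * L × j < L
  round-up t with t % L | m≡m%n+[m/n]*n t L | m%n<n t L
  ... | zero  | t≡ | _   = t / L , 0 , trans (+-identityʳ t) t≡ , >-nonZero⁻¹ L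
  ... | suc r | t≡ | r<L = suc (t / L) , L ∸ suc r , t+j≡ , ∸-monoʳ-< {o = 0} (s≤s z≤n) (<⇒≤ r<L)
    where
      open ≡-Reasoning
      t+j≡ : t + (L ∸ suc r) ≡ suc (t / L) * L
      t+j≡ = begin
        t + (L ∸ suc r)                   ≡⟨ cong (_+ (L ∸ suc r)) t≡ ⟩
        suc r + t / L * L + (L ∸ suc r)   ≡⟨ rearrange (suc r) (t / L * L) (L ∸ suc r) ⟩
        (suc r + (L ∸ suc r)) + t / L * L ≡⟨ cong (_+ t / L * L) (m+[n∸m]≡n (<⇒≤ r<L)) ⟩
        L + t / L * L                     ∎
        where
          rearrange : ∀ a b c → a + b + c ≡ (a + c) + b
          rearrange = solve-∀

  module Theorem (uniform : Uniform) (distinct : Distinct) (boundary : Boundary)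
                 {K d d′ c : ℕ} (sync : Synchronizing K d d′) (small : SmallImagesGood c)
                 (K+L≤dL : K + L ≤ d * L) (K≤d′L : K ≤ d′ * L) (c-large : 2 * (L + K + L) ≤ suc c * L + 2) where

    block-length : ∀ {a u} → u ∈ f a → length u ≡ L
    block-length {a} = All.lookup (uniform a)

    open OfLength L block-length public
    open Injective (λ {a} {b} u∈ v∈ → All.lookup (All.lookup (distinct a b) u∈) v∈ refl) public

    boundary-sound : ∀ {a b c u v w r} → u ∈ f a → v ∈ f b → w ∈ f c → r < L →
      drop r u ≡ drop r v → take r v ≡ take r w → a ≡ b ⊎ b ≡ c ⊎ ¬ Framable a b c
    boundary-sound {a} {b} {c} u∈ v∈ w∈ r<L =
      All.lookup (All.lookup (All.lookup (All.lookup (boundary a b c) u∈) v∈) w∈) (∈-upTo⁺ r<L)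

    sync-sound : ∀ {v y v′ y′ r} → Admissible v → length v ≤ d → Image v y → 1 ≤ r → r < L → r + K ≤ length y →
      Admissible v′ → length v′ ≤ d′ → Image v′ y′ → take K (drop r y) ≢ take K y′
    sync-sound adm v≤d img 1≤r r<L r+K≤y adm′ v′≤d′ img′ = All.lookup (lookup-admissible
      (All.lookup (All.lookup (lookup-admissible sync adm v≤d) (Image⇒∈images img)) (∈-upTo⁺ r<L) 1≤r r+K≤y)
      adm′ v′≤d′) (Image⇒∈images img′)

    window-aligned : ∀ {u y v w} t → Admissible u → Image u y → Admissible v → Image v w →
      t + K ≤ length y → take K (drop t y) ≡ take K w → L ∣ t
    window-aligned {u} {y} {v} {w} t adm img adm′ img′ t+K≤y eq with t % L | m≡m%n+[m/n]*n t L | m%n<n t L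
    ... | zero  | t≡ | _   = divides (t / L) t≡
    ... | suc r | t≡ | r<L = ⊥-elim (sync-sound
      (Admissible-take d _ (Admissible-drop n u adm)) (length-take-≤ d _) (take-Image d (drop-Image n img))
      (s≤s z≤n) r<L r+K≤z
      (Admissible-take d′ v adm′) (length-take-≤ d′ v) (take-Image d′ img′) eq′)
      where
        n = t / L
        z = drop (n * L) y
        r+K≤dL : suc r + K ≤ d * L
        r+K≤dL = ≤-trans (+-monoˡ-≤ K (<⇒≤ r<L)) (≤-trans (≤-reflexive (+-comm L K)) K+L≤dL)
        r+K+nL≤y : suc r + K + n * L ≤ length y
        r+K+nL≤y = begin
          suc r + K + n * L ≡⟨ rearrange (suc r) K (n * L) ⟩
          suc r + n * L + K ≡⟨ cong (_+ K) t≡ ⟨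
          t + K             ≤⟨ t+K≤y ⟩
          length y          ∎
          where
            open ≤-Reasoning
            rearrange : ∀ a b c → a + b + c ≡ a + c + b
            rearrange = solve-∀
        r+K≤z : suc r + K ≤ length (take (d * L) z)
        r+K≤z = subst (suc r + K ≤_) (sym (length-take (d * L) z))
          (⊓-glb r+K≤dL (subst (suc r + K ≤_) (sym (length-drop (n * L) y)) (m+n≤o⇒m≤o∸n (suc r + K) r+K+nL≤y)))
        eq′ : take K (drop (suc r) (take (d * L) z)) ≡ take K (take (d′ * L) w)
        eq′ = begin
          take K (drop (suc r) (take (d * L) z)) ≡⟨ take-drop-take (suc r) z r+K≤dL ⟩
          take K (drop (suc r) z)                ≡⟨ cong (take K) (drop-drop (n * L) (suc r) y) ⟩
          take K (drop (n * L + suc r) y)        ≡⟨ cong (λ i → take K (drop i y)) (trans (+-comm (n * L) (suc r)) (sym t≡)) ⟩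
          take K (drop t y)                      ≡⟨ eq ⟩
          take K w                               ≡⟨ take-take-≤ w K≤d′L ⟨
          take K (take (d′ * L) w)               ∎
          where open ≡-Reasoning

    period-long : ∀ {u y p x s} → Image u y → y ≡ p ++ (x ++ x) ++ s →
      length p < L → length s < L → c < length u → L + K ≤ length x
    period-long {u} {y} {p} {x} {s} img refl p<L s<L c<u =
      +-cancelʳ-≤ L (L + K) (length x) (*-cancelˡ-≤ 2 (begin
        2 * (L + K + L)                              ≤⟨ c-large ⟩
        suc c * L + 2                                ≤⟨ +-monoˡ-≤ 2 (*-monoˡ-≤ L c<u) ⟩
        length u * L + 2                             ≡⟨ cong (_+ 2) (trans (sym (length-Image img)) (length-square p x s)) ⟩
        length p + ((length x + length x) + length s) + 2 ≡⟨ rearrange (length p) (length x) (length s) ⟩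
        (length x + length x) + (suc (length p) + suc (length s)) ≤⟨ +-monoʳ-≤ (length x + length x) (+-mono-≤ p<L s<L) ⟩
        (length x + length x) + (L + L)              ≡⟨ double (length x) L ⟩
        2 * (length x + L)                           ∎))
      where
        open ≤-Reasoning
        rearrange : ∀ q ℓ σ → q + ((ℓ + ℓ) + σ) + 2 ≡ (ℓ + ℓ) + (suc q + suc σ)
        rearrange = solve-∀
        double : ∀ ℓ L → (ℓ + ℓ) + (L + L) ≡ 2 * (ℓ + L)
        double = solve-∀

    period-aligned : ∀ {u y p x s} → Admissible u → Image u y → y ≡ p ++ (x ++ x) ++ s → L + K ≤ length x → L ∣ length x
    period-aligned {u} {y} {p} {x} {s} adm img refl L+K≤x with round-up (length p + length x)
    ... | k , j , B≡ , j<L = ∣m+n∣m⇒∣n (divides k (trans (rearrange (length p) (length x) j) B≡))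
      (window-aligned (length p + j) adm img (Admissible-drop k u adm) (drop-Image k img) bound window)
      where
        rearrange : ∀ q ℓ j → q + j + ℓ ≡ q + ℓ + j
        rearrange = solve-∀
        j+K≤x : j + K ≤ length x
        j+K≤x = ≤-trans (+-monoˡ-≤ K (<⇒≤ j<L)) L+K≤x
        bound : length p + j + K ≤ length y
        bound = begin
          length p + j + K              ≡⟨ +-assoc (length p) j K ⟩
          length p + (j + K)            ≤⟨ +-monoʳ-≤ (length p) (≤-trans j+K≤x (≤-trans (m≤m+n _ _) (m≤m+n _ (length s)))) ⟩
          length p + ((length x + length x) + length s) ≡⟨ length-square p x s ⟨
          length y                      ∎
          where open ≤-Reasoning
        window : take K (drop (length p + j) y) ≡ take K (drop (k * L) y)
        window = trans (take-drop-square p x s j+K≤x) (cong (λ i → take K (drop i y)) B≡)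

    offset≤block : ∀ {a u n} → u ∈ f a → n < L → n ≤ length u
    offset≤block u∈ n<L = ≤-trans (<⇒≤ n<L) (≤-reflexive (sym (block-length u∈)))

    tails-length : ∀ {a b} p e {g g′} → p ++ g ∈ f a → e ++ g′ ∈ f b → length e ≡ length p → length g ≡ length g′
    tails-length p e {g} {g′} pg∈ eg′∈ e≡p = +-cancelˡ-≡ (length p) (length g) (length g′) (begin
      length p + length g  ≡⟨ length-++ p ⟨
      length (p ++ g)      ≡⟨ trans (block-length pg∈) (sym (block-length eg′∈)) ⟩
      length (e ++ g′)     ≡⟨ length-++ e ⟩
      length e + length g′ ≡⟨ cong (_+ length g′) e≡p ⟩
      length p + length g′ ∎)
      where open ≡-Reasoning

    ¬shifted-square : ∀ {U V Y Z p x e s} → Admissible (U ++ V) → Image U Y → Image V Z →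
      p ++ x ≡ Y ++ e → Z ≡ e ++ (x ++ s) → length e ≡ length p →
      1 ≤ length e → length p < L → length s < L → x ≢ [] → ⊥
    ¬shifted-square {p = p} {e = e} _ [] _ eq₁ _ e≡p _ _ _ x≢[] =
      x≢[] (proj₂ (++-cancel-length p e (sym e≡p) (trans eq₁ (sym (++-identityʳ e)))))
    ¬shifted-square {e = e} _ (_ ∷ _) [] _ eq₂ _ 1≤e _ _ _ =
      <⇒≢ 1≤e (sym (cong length (++-conicalˡ e _ (sym eq₂))))
    ¬shifted-square {p = p} {e = e} {s} adm (_∷_ {w = M} {u₀} {YM} u₀∈ iM) (_∷_ {u = u₁} u₁∈ iN)
                   eq₁ eq₂ e≡p 1≤e p<L s<L _
      -- u ≡ a₀ ∷ M ++ a₁ ∷ M ++ [ a₂ ] with blocks u₀ ≡ p ++ g₀, u₁ ≡ e ++ g₀ and u₂ ≡ e ++ s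
      with g₀ , refl , refl ← levi p u₀ (trans eq₁ (++-assoc u₀ YM e)) (offset≤block u₀∈ p<L)
      with g₁ , refl , eq₃ ← levi e u₁ (sym eq₂) (offset≤block u₁∈ (subst (_< L) (sym e≡p) p<L))
      with refl , YN≡ ← ++-cancel-length g₀ g₁ (tails-length p e u₀∈ u₁∈ e≡p) (trans (sym (++-assoc g₀ _ s)) eq₃)
      with N₂ , refl , iN₂ ← Image-prefix iM iN (trans (sym YN≡) (++-assoc YM e s))
      with a₂ , refl , u₂∈ ← Image-single iN₂ (λ es≡[] → <⇒≢ 1≤e (sym (cong length (++-conicalˡ e s es≡[]))))
                                              (subst (_< L + L) (sym (length-++ e)) (+-mono-< (subst (_< L) (sym e≡p) p<L) s<L))
      = ¬framed M adm (boundary-sound u₀∈ u₁∈ u₂∈ p<L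
          (trans (drop-length-++ p g₀) (sym (drop-++-length e g₀ e≡p)))
          (trans (take-++-length e g₀ e≡p) (sym (take-++-length e s e≡p))))

    ¬aligned-square : ∀ {u y p x s} → Admissible u → Image u y → y ≡ p ++ (x ++ x) ++ s → L ∣ length x →
      length p < L → length s < L → x ≢ [] → ⊥
    ¬aligned-square {u} {p = []} {x} {s} adm img refl (divides m x≡) _ _ x≢[] =
      square (Image-prefix M-img img (++-assoc x x s))
      where
        M = take m u
        M-img : Image M x
        M-img = Image-take-prefix m img (++-assoc x x s) x≡
        M≢[] : M ≢ []
        M≢[] M≡[] = x≢[] (Image-[] (subst (λ v → Image v x) M≡[] M-img))
        square : ∃[ w ] u ≡ M ++ w × Image w (x ++ s) → ⊥
        square (w , u≡ , img₁) with w′ , refl , _ ← Image-prefix M-img img₁ refl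
          = proj₁ adm [] M w′ M≢[] (trans u≡ (sym (++-assoc M M w′)))
    ¬aligned-square {u} {p = p@(_ ∷ _)} {x} {s} adm img refl (divides m x≡) p<L s<L x≢[] =
      shift (Image-prefix Y-img img y≡)
      where
        Y = take (length x) (p ++ x)
        e = drop (length x) (p ++ x)
        y≡ : p ++ (x ++ x) ++ s ≡ Y ++ (e ++ (x ++ s))
        y≡ = begin
          p ++ (x ++ x) ++ s  ≡⟨ cong (p ++_) (++-assoc x x s) ⟩
          p ++ x ++ x ++ s    ≡⟨ ++-assoc p x (x ++ s) ⟨
          (p ++ x) ++ x ++ s  ≡⟨ cong (_++ x ++ s) (take++drop≡id (length x) (p ++ x)) ⟨
          (Y ++ e) ++ x ++ s  ≡⟨ ++-assoc Y e (x ++ s) ⟩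
          Y ++ e ++ x ++ s    ∎
          where open ≡-Reasoning
        Y≡ : length Y ≡ m * L
        Y≡ = trans (length-take (length x) (p ++ x)) (trans (m≤n⇒m⊓n≡m (length-++-≤ʳ x {p})) x≡)
        e≡p : length e ≡ length p
        e≡p = trans (length-drop (length x) (p ++ x)) (trans (cong (_∸ length x) (length-++ p)) (m+n∸n≡m (length p) (length x)))
        Y-img : Image (take m u) Y
        Y-img = Image-take-prefix m img y≡ Y≡
        shift : ∃[ w ] u ≡ take m u ++ w × Image w (e ++ (x ++ s)) → ⊥
        shift (w , u≡ , img₂) = ¬shifted-square (subst Admissible u≡ adm) Y-img img₂
          (sym (take++drop≡id (length x) (p ++ x))) refl e≡p (subst (1 ≤_) (sym e≡p) (s≤s z≤n)) p<L s<L x≢[]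

    record Occurrence (z : List X) : Set where
      constructor occurrence
      field
        {word}             : List Σ₅
        {image left right} : List X
        admissible         : Admissible word
        isImage            : Image word image
        split              : image ≡ left ++ z ++ right

    open Occurrence

    trim-right : ∀ {z} → Occurrence z → Σ[ o ∈ Occurrence z ] length (right o) < L
    trim-right {z} (occurrence {w} {left = p} {s} adm img refl) with round-up (length (p ++ z))
    ... | k , j , k≡ , j<L =
      occurrence {left = p} {take j s} (Admissible-take k w adm) (take-Image k img) split′ , ≤-<-trans (length-take-≤ j s) j<L
      where
        split′ : take (k * L) (p ++ z ++ s) ≡ p ++ z ++ take j s
        split′ = begin
          take (k * L) (p ++ z ++ s)                 ≡⟨ cong₂ take (sym k≡) (sym (++-assoc p z s)) ⟩
          take (length (p ++ z) + j) ((p ++ z) ++ s) ≡⟨ take-++-+ (p ++ z) s j refl ⟩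
          (p ++ z) ++ take j s                       ≡⟨ ++-assoc p z (take j s) ⟩
          p ++ z ++ take j s                         ∎
          where open ≡-Reasoning

    trim-left : ∀ {z w y} p s → Admissible w → Image w y → y ≡ p ++ z ++ s →
      Σ[ o ∈ Occurrence z ] length (left o) < L × right o ≡ s
    trim-left p s adm img eq with length p <? L
    ... | yes p<L = occurrence {left = p} {s} adm img eq , p<L , refl
    trim-left {z} p s adm [] eq | no p≮L =
      ⊥-elim (p≮L (subst (_< L) (sym (cong length (++-conicalˡ p (z ++ s) (sym eq)))) (>-nonZero⁻¹ L)))
    trim-left p s adm (_∷_ {a} {w} {u} u∈ img) eq | no p≮L
      with p′ , refl , eq′ ← levi u p eq (≤-trans (≤-reflexive (block-length u∈)) (≮⇒≥ p≮L))
      = trim-left p′ s (Admissible-++⁻ʳ [ a ] w adm) img eq′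

    tight-square-good : ∀ {x} (o : Occurrence (x ++ x)) → length (left o) < L → length (right o) < L → x ≢ [] →
      Good (x ++ x)
    tight-square-good {x} (occurrence {w} {left = p} {s} adm img eq) p<L s<L x≢[] with length w ≤? c
    ... | yes w≤c = TightSquaresGood-sound {p = p} {x} {s} (All.lookup (lookup-admissible small adm w≤c) (Image⇒∈images img))
                      eq p<L s<L x≢[]
    ... | no  w≰c = ⊥-elim (¬aligned-square {p = p} {x} {s} adm img eq (period-aligned {p = p} {x} {s} adm img eq long) p<L s<L x≢[])
      where long = period-long {p = p} {x} {s} img eq p<L s<L (≰⇒> w≰c)

    squares-good : ∀ {u y} → Admissible u → Image u y → AllSquares Good y
    squares-good adm img p x s x≢[] eq
      with o , s<L ← trim-right (occurrence {left = p} {s} adm img eq)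
      with o′ , p<L , refl ← trim-left {z = x ++ x} (left o) (right o) (admissible o) (isImage o) (split o)
      = tight-square-good o′ p<L s<L x≢[]

-- Local admissibility of images

module _ (f : Σ₅ → List (List Σ₅)) where

  open Substitution f

  LocalBlocks : Set
  LocalBlocks = ∀ a → All LocallyAdmissible (f a)

  LocalJoins : Set
  LocalJoins = ∀ a b → Edge a b → All (λ u → All (λ v → LocallyAdmissible (u ++ v)) (f b)) (f a)

  localBlocks? : Dec LocalBlocks
  localBlocks? = Fin.all? λ a → All.all? locallyAdmissible? (f a)

  localJoins? : Dec LocalJoins
  localJoins? = Fin.all? λ a → Fin.all? λ b →
    T? (edge a b) →-dec All.all? (λ u → All.all? (λ v → locallyAdmissible? (u ++ v)) (f b)) (f a)

  LocallyAdmissible-Image : LocalBlocks → LocalJoins → (∀ {a u} → u ∈ f a → 2 ≤ length u) →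
    ∀ {w y} → LocallyAdmissible w → Image w y → LocallyAdmissible y
  LocallyAdmissible-Image blocks joins long = go
    where
      go : ∀ {w y} → LocallyAdmissible w → Image w y → LocallyAdmissible y
      go _  [] = []
      go {a ∷ []} _ (_∷_ {u = u} u∈ []) =
        subst LocallyAdmissible (sym (++-identityʳ u)) (All.lookup (blocks a) u∈)
      go {a ∷ b ∷ w} la (_∷_ {u = u} u∈ (_∷_ {u = v} {v = y} v∈ img)) =
        LocallyAdmissible-glue u v y (long v∈)
          (All.lookup (All.lookup (joins a b (LocallyAdmissible⇒Edge la)) u∈) v∈)
          (go (LocallyAdmissible-++⁻ʳ [ a ] (b ∷ w) la) (v∈ ∷ img))

module H′ = Substitution h'₁
module H′-test = SquareTest h'₁ 24 (λ _ → ⊥)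
module H′-decide = H′-test.Decide Fin._≟_ (λ _ → no λ ())

-- K = 28 is the least synchronisation length of h′, and d, d′, c are the least values allowed by it.
module H′-squares = H′-test.Theorem
  (from-yes H′-decide.uniform?) (from-yes H′-decide.distinct?) (from-yes H′-decide.boundary?)
  (from-yes (H′-decide.synchronizing? 28 3 2)) (from-yes (H′-decide.smallImagesGood? 6))
  (≤ᵇ⇒≤ _ _ _) (≤ᵇ⇒≤ _ _ _) (≤ᵇ⇒≤ _ _ _)

h′-admissible : ∀ {w u} → Admissible w → H′.Image w u → Admissible u
h′-admissible adm img = H′-squares.squares-good adm img ,
  LocallyAdmissible-Image h'₁ (from-yes (localBlocks? h'₁)) (from-yes (localJoins? h'₁))
    (λ u∈ → subst (2 ≤_) (sym (H′-squares.block-length u∈)) (≤ᵇ⇒≤ _ _ _)) (proj₂ adm) img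

InH'⇒Image : ∀ {w u} → InH' w u → H′.Image w u
InH'⇒Image nil         = H′.[]
InH'⇒Image (cons u∈ i) = u∈ H′.∷ InH'⇒Image i

Image⇒InH' : ∀ {w u} → H′.Image w u → InH' w u
Image⇒InH' H′.[]        = nil
Image⇒InH' (u∈ H′.∷ i) = cons u∈ (Image⇒InH' i)

h∈h′ : ∀ a → h a ∈ h'₁ a
h∈h′ #0 = here refl
h∈h′ #1 = here refl
h∈h′ #2 = here refl
h∈h′ #3 = here refl
h∈h′ #4 = here refl

Image-hw : ∀ v → H′.Image v (hw v)
Image-hw []      = H′.[]
Image-hw (a ∷ v) = h∈h′ a H′.∷ Image-hw v

admissible-hpow : ∀ m → Admissible (hpow m [ #0 ])
admissible-hpow zero    = from-yes (admissible? [ #0 ])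
admissible-hpow (suc m) = h′-admissible (admissible-hpow m) (Image-hw (hpow m [ #0 ]))

length-hpow : ∀ m → length (hpow m [ #0 ]) ≡ 24 ^ m
length-hpow zero    = refl
length-hpow (suc m) = begin
  length (hw (hpow m [ #0 ])) ≡⟨ H′-squares.length-Image (Image-hw (hpow m [ #0 ])) ⟩
  length (hpow m [ #0 ]) * 24 ≡⟨ cong (_* 24) (length-hpow m) ⟩
  24 ^ m * 24                 ≡⟨ *-comm (24 ^ m) 24 ⟩
  24 ^ suc m                  ∎
  where open ≡-Reasoning

AllowedSquare : List Bin → Set
AllowedSquare z = z ≡ b0 ∷ b0 ∷ [] ⊎ z ≡ b1 ∷ b1 ∷ [] ⊎ z ≡ b0 ∷ b1 ∷ b0 ∷ b1 ∷ []

allowedSquare? : Decidable AllowedSquare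
allowedSquare? z = (z ≟ₗ _) ⊎-dec (z ≟ₗ _) ⊎-dec (z ≟ₗ _)
  where _≟ₗ_ = ≡-dec Fin._≟_

g′ : Σ₅ → List (List Bin)
g′ a = [ g₁ a ]

module G′ = Substitution g′
module G′-test = SquareTest g′ 6 AllowedSquare
module G′-decide = G′-test.Decide Fin._≟_ allowedSquare?

-- As for h′, K = 17 is the least synchronisation length of g.
module G′-squares = G′-test.Theorem
  (from-yes G′-decide.uniform?) (from-yes G′-decide.distinct?) (from-yes G′-decide.boundary?)
  (from-yes (G′-decide.synchronizing? 17 4 3)) (from-yes (G′-decide.smallImagesGood? 9))
  (≤ᵇ⇒≤ _ _ _) (≤ᵇ⇒≤ _ _ _) (≤ᵇ⇒≤ _ _ _)

Image-g : ∀ u → G′.Image u (g u)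
Image-g []      = G′.[]
Image-g (a ∷ u) = here refl G′.∷ Image-g u

g-injective : ∀ {u u′} → g u ≡ g u′ → u ≡ u′
g-injective {u} {u′} eq = G′-squares.Image-injective (Image-g u) (subst (G′.Image u′) (sym eq) (Image-g u′))

length-g∘h′ : ∀ m {u} → InH' (hpow m [ #0 ]) u → length (g u) ≡ 144 * 24 ^ m
length-g∘h′ m {u} iu = begin
  length (g u)                  ≡⟨ G′-squares.length-Image (Image-g u) ⟩
  length u * 6                  ≡⟨ cong (_* 6) (H′-squares.length-Image (InH'⇒Image iu)) ⟩
  length (hpow m [ #0 ]) * 24 * 6 ≡⟨ cong (λ n → n * 24 * 6) (length-hpow m) ⟩
  24 ^ m * 24 * 6               ≡⟨ rearrange (24 ^ m) ⟩
  144 * 24 ^ m                  ∎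
  where
    open ≡-Reasoning
    rearrange : ∀ n → n * 24 * 6 ≡ 144 * n
    rearrange = solve-∀

squares-g∘h′ : ∀ m {u} → InH' (hpow m [ #0 ]) u → OnlyAllowedSquares (g u)
squares-g∘h′ m {u} iu = G′-squares.squares-good (h′-admissible (admissible-hpow m) (InH'⇒Image iu)) (Image-g u)

product-hw : ∀ v → 2 ^ (3 * length v) ≤ product (map (length ∘ h'₁) (hw v))
product-hw []      = ≤-refl
product-hw (a ∷ v) = begin
  2 ^ (3 * suc (length v))                       ≡⟨ cong (2 ^_) (*-suc 3 (length v)) ⟩
  2 ^ (3 + 3 * length v)                         ≡⟨ ^-distribˡ-+-* 2 3 (3 * length v) ⟩
  8 * 2 ^ (3 * length v)                         ≤⟨ *-mono-≤ (8≤product a) (product-hw v) ⟩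
  product (map φ (h a)) * product (map φ (hw v)) ≡⟨ product-++ (map φ (h a)) (map φ (hw v)) ⟨
  product (map φ (h a) ++ map φ (hw v))          ≡⟨ cong product (map-++ φ (h a) (hw v)) ⟨
  product (map φ (hw (a ∷ v)))                   ∎
  where
    open ≤-Reasoning
    φ : Σ₅ → ℕ
    φ = length ∘ h'₁
    8≤product : ∀ a → 8 ≤ product (map φ (h a))
    8≤product = from-yes (Fin.all? λ a → 8 ≤? product (map φ (h a)))

images-g∘h′-unique : ∀ w → Unique (map g (H′.images w))
images-g∘h′-unique = Unique.map⁺ g-injective ∘ H′-squares.Unique-images (from-yes (Fin.all? λ a → unique? (h'₁ a)))

images-g∘h′-sound : ∀ w → All (InGH' w) (map g (H′.images w))
images-g∘h′-sound w = All.map⁺ (All.tabulate λ {u} u∈ → u , Image⇒InH' (H′.∈images⇒Image w u∈) , refl)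

images-g∘h′-many : ∀ m → 2 ^ ((144 * 24 ^ suc m) / 1152) ≤ length (map g (H′.images (hpow (suc m) [ #0 ])))
images-g∘h′-many m = begin
  2 ^ ((144 * 24 ^ suc m) / 1152)     ≡⟨ cong (λ n → 2 ^ (n / 1152)) (rearrange (24 ^ m)) ⟩
  2 ^ (3 * 24 ^ m * 1152 / 1152)      ≡⟨ cong (2 ^_) (trans (m*n/n≡m (3 * 24 ^ m) 1152) (cong (3 *_) (sym (length-hpow m)))) ⟩
  2 ^ (3 * length (hpow m [ #0 ]))    ≤⟨ product-hw (hpow m [ #0 ]) ⟩
  product (map (length ∘ h'₁) w)      ≡⟨ H′.length-images w ⟨
  length (H′.images w)                ≡⟨ length-map g (H′.images w) ⟨
  length (map g (H′.images w))        ∎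
  where
    open ≤-Reasoning
    w = hpow (suc m) [ #0 ]
    rearrange : ∀ n → 144 * (24 * n) ≡ 3 * n * 1152
    rearrange = solve-∀

lemma11 : (m : ℕ) → 1 ≤ m →
    ((∀ (y : List Bin) → InGH' (hpow m [ #0 ]) y →
        length y ≡ 144 * 24 ^ m × OnlyAllowedSquares y)
    × ∃ λ (L : List (List Bin)) →
        Unique L × All (InGH' (hpow m [ #0 ])) L × 2 ^ ((144 * 24 ^ m) / 1152) ≤ length L)
lemma11 zero    ()
lemma11 (suc m) _ =
  (λ { _ (u , iu , refl) → length-g∘h′ (suc m) iu , squares-g∘h′ (suc m) iu }) ,
  map g (H′.images w) , images-g∘h′-unique w , images-g∘h′-sound w , images-g∘h′-many m
  where w = hpow (suc m) [ #0 ]
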